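{- For every integer $n\ge 3$, the graph $G_n$ satisfies $\rho(G_n)> \left\lfloor \sqrt{2n-1}\right\rfloor+1$.
   Context: Rubbling: a pebble distribution on a graph $G$ is a function $p:V(G)\to\mathbb{Z}_{\ge0}$, of size $\sum_v p(v)$. The pebbling move $(v,v\to u)$ (for an edge $\{v,u\}$) removes two pebbles from $v$ and adds one at $u$; the strict rubbling move $(v,w\to u)$ (for $v\ne w$, both adjacent to $u$) removes one pebble from each of $v,w$ and adds one at $u$. A vertex is reachable from $p$ if some finite sequence of these moves, keeping all intermediate distributions nonnegative, puts at least one pebble on it. The rubbling number $\rho(G)$ is the least $m$ such that every vertex is reachable from every distribution of size $m$. Construction of $G_n$: For a positive integer $s$, let $H_s$ have vertex set $\{(i,j): 1\le i\le j\le s\}$, with $(i_1,j_1)$ and $(i_2,j_2)$ (distinct) adjacent iff $i_1=i_2$ or $j_1=j_2$. Let $H'_s$ be obtained from $H_s$ as follows: if $s$ is odd, delete the vertices $(2t,2t+1)$ for $1\le t\le (s-1)/2$ and add the edges $\{(2t+1,2t+1),(2t,2t)\}$ for $1\le t\le (s-1)/2$; if $s$ is even, delete the vertices $(2t-1,2t)$ for $2\le t\le s/2$ and add the edges $\{(2t,2t),(2t-1,2t-1)\}$ for $2\le t\le s/2$. Then $|V(H'_s)|=s(s+1)/2-\lfloor (s-1)/2\rfloor$. For $n\ge3$: if $n=|V(H'_s)|$ for some $s$, let $G_n=H'_s$. Otherwise $|V(H'_s)|<n<|V(H'_{s+1})|$ for a unique $s$, and $G_n$ is obtained from $H'_s$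 by adding the vertices $(0,s),(0,s-1),(0,s-2),\ldots$ one by one, in this order, until the graph has $n$ vertices; each new vertex $(0,j)$ is made adjacent to every other vertex $(i',j')$ present with $i'=0$ or $j'=j$. -}

module Defs where

open import Data.Nat using (ℕ; zero; suc; _+_; _*_; _∸_; _≤_; _<_)
open import Data.Nat.DivMod using (_/_; _%_)
open import Data.Product using (_×_; _,_; proj₁; proj₂; ∃; ∃-syntax)
open import Data.Product.Properties using (≡-dec)
open import Data.Sum using (_⊎_)
open import Data.Bool using (if_then_else_)
open import Relation.Nullary using (¬_)
open import Relation.Nullary.Decidable using (⌊_⌋)
open import Relation.Binary.PropositionalEquality using (_≡_; _≢_)
open import Relation.Binary.Construct.Closure.ReflexiveTransitive using (Star)
import Data.Nat as N

Vtx : Set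
Vtx = ℕ × ℕ

_≟V_ : (x y : Vtx) → Relation.Nullary.Dec (x ≡ y)
_≟V_ = ≡-dec N._≟_ N._≟_

δ : Vtx → Vtx → ℕ
δ x v = if ⌊ x ≟V v ⌋ then 1 else 0

Deleted : ℕ → Vtx → Set
Deleted s (i , j) =
    (s % 2 ≡ 1 × ∃[ t ] (1 ≤ t × 2 * t + 1 ≤ s × i ≡ 2 * t × j ≡ 2 * t + 1))
  ⊎ (s % 2 ≡ 0 × ∃[ t ] (2 ≤ t × 2 * t ≤ s × i ≡ 2 * t ∸ 1 × j ≡ 2 * t))

-- The (oriented) extra edges added when forming H'_s.
Extra : ℕ → Vtx → Vtx → Set
Extra s x y =
    (s % 2 ≡ 1 × ∃[ t ] (1 ≤ t × 2 * t + 1 ≤ s ×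
        x ≡ (2 * t + 1 , 2 * t + 1) × y ≡ (2 * t , 2 * t)))
  ⊎ (s % 2 ≡ 0 × ∃[ t ] (2 ≤ t × 2 * t ≤ s ×
        x ≡ (2 * t , 2 * t) × y ≡ (2 * t ∸ 1 , 2 * t ∸ 1)))

VertexH' : ℕ → Vtx → Set
VertexH' s (i , j) = 1 ≤ i × i ≤ j × j ≤ s × ¬ Deleted s (i , j)

sizeH' : ℕ → ℕ
sizeH' s = (s * suc s) / 2 ∸ (s ∸ 1) / 2

-- The graph G_n, for s with sizeH' s ≤ n < sizeH' (s + 1).
-- The k = n ∸ sizeH' s added vertices are (0,s),(0,s-1),…,(0,s-k+1).

VertexG : ℕ → ℕ → Vtx → Set
VertexG n s (i , j) =
  VertexH' s (i , j) ⊎ (i ≡ 0 × j ≤ s × s < j + (n ∸ sizeH' s))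

-- Adjacency (on vertices of G_n): distinct and same first or same second
-- coordinate (this covers H_s and the rule for the new vertices (0,j)),
-- or one of the extra edges of H'_s.
AdjG : ℕ → Vtx → Vtx → Set
AdjG s x y =
  x ≢ y × (proj₁ x ≡ proj₁ y ⊎ proj₂ x ≡ proj₂ y ⊎ Extra s x y ⊎ Extra s y x)

Dist : Set
Dist = Vtx → ℕ

IsDist : ℕ → ℕ → Dist → Set
IsDist n s p = ∀ x → ¬ VertexG n s x → p x ≡ 0

sumTo : ℕ → (ℕ → ℕ) → ℕ
sumTo zero    f = 0
sumTo (suc k) f = f k + sumTo k f

-- Size of p: sum over the grid [0,n]×[0,n], which contains V(G_n).
size : ℕ → Dist → ℕ
size n p = sumTo (suc n) (λ i → sumTo (suc n) (λ j → p (i , j)))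

-- One move, q being the result: q x + (removed at x) = p x + (added at x).
data Move (n s : ℕ) (p q : Dist) : Set where
  pebbling : (v u : Vtx) → VertexG n s v → VertexG n s u → AdjG s v u →
             (∀ x → q x + 2 * δ x v ≡ p x + δ x u) → Move n s p q
  rubbling : (v w u : Vtx) → VertexG n s v → VertexG n s w → VertexG n s u →
             v ≢ w → AdjG s v u → AdjG s w u →
             (∀ x → q x + (δ x v + δ x w) ≡ p x + δ x u) → Move n s p q

Reachable : ℕ → ℕ → Dist → Vtx → Set
Reachable n s p v = ∃[ q ] (Star (Move n s) p q × 1 ≤ q v)

AllReachable : ℕ → ℕ → ℕ → Set
AllReachable n s m =
  ∀ p → IsDist n s p → size n p ≡ m → ∀ v → VertexG n s v → Reachable n s p v

-- Line k of G_n consists of the vertices with a coordinate equal to k.  Every edge of G_n joins two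
-- vertices on a common line, except the extra edges of H'_s between diagonal vertices, and all
-- neighbours of (1 , 1) lie on line 1; so (1 , 1) is reached only once two pebbles sit on line 1.
--
-- Let load₁ p count the pebbles on line 1, load p k the pebbles on line k but off line 1, and let the
-- excess be Σ_k (load p k ∸ 1).  Call p blocked if (1 , 1) is empty, excess + 2 · load₁ ≤ 2, and, when
-- the excess is 2, some pebbled vertex off line 1 (a hub) lies on every line of load at least 2.
-- Moves preserve being blocked: a pebble enters line 1 only from two pebbles on one line K, which uses
-- up excess, and the hub rules out the borderline case where K carries exactly two pebbles.
-- Putting min(3, m) pebbles on (s , s) and single pebbles on m - 3 other diagonal vertices gives a
-- blocked distribution of size m for every m ≤ s + 1, and ⌊√(2n-1)⌋ + 1 ≤ s + 1.

module Submission where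

open import Data.Empty using (⊥; ⊥-elim)
open import Data.Nat using (ℕ; zero; suc; _+_; _*_; _∸_; _⊓_; _≤_; _<_; z≤n; s≤s; s≤s⁻¹; _≟_; _≤?_; _<?_)
open import Data.Nat.DivMod using (_/_; m/n*n≤m; m%n<n; m≡m%n+[m/n]*n)
open import Data.Nat.Properties
open import Data.Nat.Tactic.RingSolver using (solve-∀)
open import Algebra.Properties.CommutativeSemigroup +-commutativeSemigroup using (interchange; xy∙z≈xz∙y)
open import Data.Product using (_×_; _,_; proj₁; proj₂; ∃-syntax)
open import Data.Sum using (_⊎_; inj₁; inj₂)
open import Function using (_∘_)
open import Relation.Binary.PropositionalEquality
open import Relation.Binary.Construct.Closure.ReflexiveTransitive using (Star; ε; _◅_)
open import Relation.Nullary using (¬_; Dec; yes; no)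
open import Defs

sumTo-cong : ∀ N {f g : ℕ → ℕ} → (∀ i → i < N → f i ≡ g i) → sumTo N f ≡ sumTo N g
sumTo-cong zero    f≡g = refl
sumTo-cong (suc N) f≡g = cong₂ _+_ (f≡g N ≤-refl) (sumTo-cong N (λ i i<N → f≡g i (m<n⇒m<1+n i<N)))

sumTo-zeros : ∀ N → sumTo N (λ _ → 0) ≡ 0
sumTo-zeros zero    = refl
sumTo-zeros (suc N) = sumTo-zeros N

sumTo-vanishing : ∀ N {f : ℕ → ℕ} → (∀ i → i < N → f i ≡ 0) → sumTo N f ≡ 0
sumTo-vanishing N f≡0 = trans (sumTo-cong N f≡0) (sumTo-zeros N)

sumTo-+ : ∀ N (f g : ℕ → ℕ) → sumTo N (λ i → f i + g i) ≡ sumTo N f + sumTo N g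
sumTo-+ zero    f g = refl
sumTo-+ (suc N) f g =
  trans (cong (f N + g N +_) (sumTo-+ N f g)) (interchange (f N) (g N) (sumTo N f) (sumTo N g))

sumTo-mono-≤ : ∀ N {f g : ℕ → ℕ} → (∀ i → i < N → f i ≤ g i) → sumTo N f ≤ sumTo N g
sumTo-mono-≤ zero    f≤g = z≤n
sumTo-mono-≤ (suc N) f≤g = +-mono-≤ (f≤g N ≤-refl) (sumTo-mono-≤ N (λ i i<N → f≤g i (m<n⇒m<1+n i<N)))

sumTo-concentrated : ∀ N (f : ℕ → ℕ) {a} → a < N → (∀ i → i ≢ a → f i ≡ 0) → sumTo N f ≡ f a
sumTo-concentrated (suc N) f {a} a<1+N f≡0 with N ≟ a
... | yes refl = trans (cong (f N +_) (sumTo-vanishing N (λ i i<N → f≡0 i (<⇒≢ i<N)))) (+-identityʳ (f N))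
... | no N≢a   = trans (cong (_+ sumTo N f) (f≡0 N N≢a))
                       (sumTo-concentrated N f (≤∧≢⇒< (s≤s⁻¹ a<1+N) (N≢a ∘ sym)) f≡0)

sumTo-drop : ∀ N {f g : ℕ → ℕ} {k a} → k < N → (∀ j → f j ≤ g j) → f k + a ≤ g k →
  sumTo N f + a ≤ sumTo N g
sumTo-drop (suc N) {f} {g} {k} {a} k<1+N f≤g fk+a≤gk with k ≟ N
... | yes refl = begin
    f k + sumTo k f + a ≡⟨ xy∙z≈xz∙y (f k) (sumTo k f) a ⟩
    f k + a + sumTo k f ≤⟨ +-mono-≤ fk+a≤gk (sumTo-mono-≤ k (λ j _ → f≤g j)) ⟩
    g k + sumTo k g     ∎
  where open ≤-Reasoning
... | no k≢N = begin
    f N + sumTo N f + a   ≡⟨ +-assoc (f N) _ a ⟩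
    f N + (sumTo N f + a) ≤⟨ +-mono-≤ (f≤g N) (sumTo-drop N (≤∧≢⇒< (s≤s⁻¹ k<1+N) k≢N) f≤g fk+a≤gk) ⟩
    g N + sumTo N g       ∎
  where open ≤-Reasoning

sumTo-drop₂ : ∀ N {f g : ℕ → ℕ} {k l a b} → k ≢ l → k < N → l < N → (∀ j → f j ≤ g j) →
  f k + a ≤ g k → f l + b ≤ g l → sumTo N f + (a + b) ≤ sumTo N g
sumTo-drop₂ (suc N) {f} {g} {k} {l} {a} {b} k≢l k<1+N l<1+N f≤g fk+a≤gk fl+b≤gl with k ≟ N | l ≟ N
... | yes refl | yes refl = ⊥-elim (k≢l refl)
... | yes refl | no l≢N = begin
    f k + sumTo k f + (a + b)   ≡⟨ interchange (f k) _ a b ⟩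
    f k + a + (sumTo k f + b)   ≤⟨ +-mono-≤ fk+a≤gk (sumTo-drop k (≤∧≢⇒< (s≤s⁻¹ l<1+N) l≢N) f≤g fl+b≤gl) ⟩
    g k + sumTo k g             ∎
  where open ≤-Reasoning
... | no k≢N | yes refl = begin
    f l + sumTo l f + (a + b)   ≡⟨ cong (f l + sumTo l f +_) (+-comm a b) ⟩
    f l + sumTo l f + (b + a)   ≡⟨ interchange (f l) _ b a ⟩
    f l + b + (sumTo l f + a)   ≤⟨ +-mono-≤ fl+b≤gl (sumTo-drop l (≤∧≢⇒< (s≤s⁻¹ k<1+N) k≢N) f≤g fk+a≤gk) ⟩
    g l + sumTo l g             ∎
  where open ≤-Reasoning
... | no k≢N | no l≢N = begin
    f N + sumTo N f + (a + b)   ≡⟨ +-assoc (f N) _ _ ⟩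
    f N + (sumTo N f + (a + b)) ≤⟨ +-mono-≤ (f≤g N) (sumTo-drop₂ N k≢l (≤∧≢⇒< (s≤s⁻¹ k<1+N) k≢N)
                                                     (≤∧≢⇒< (s≤s⁻¹ l<1+N) l≢N) f≤g fk+a≤gk fl+b≤gl) ⟩
    g N + sumTo N g             ∎
  where open ≤-Reasoning

term≤sumTo : ∀ N (f : ℕ → ℕ) {k} → k < N → f k ≤ sumTo N f
term≤sumTo N f k<N =
  subst (_≤ sumTo N f) (cong (_+ f _) (sumTo-zeros N)) (sumTo-drop N k<N (λ _ → z≤n) ≤-refl)

two-terms≤sumTo : ∀ N (f : ℕ → ℕ) {k l} → k ≢ l → k < N → l < N → f k + f l ≤ sumTo N f
two-terms≤sumTo N f k≢l k<N l<N =
  subst (_≤ sumTo N f) (cong (_+ _) (sumTo-zeros N)) (sumTo-drop₂ N k≢l k<N l<N (λ _ → z≤n) ≤-refl ≤-refl)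

≡⊎≢ : ∀ (a b : ℕ) → a ≡ b ⊎ a ≢ b
≡⊎≢ a b with a ≟ b
... | yes a≡b = inj₁ a≡b
... | no  a≢b = inj₂ a≢b

point : ℕ → ℕ → ℕ
point a i with i ≟ a
... | yes _ = 1
... | no  _ = 0

point-self : ∀ a → point a a ≡ 1
point-self a with a ≟ a
... | yes _   = refl
... | no a≢a = ⊥-elim (a≢a refl)

point-other : ∀ {a i} → i ≢ a → point a i ≡ 0
point-other {a} {i} i≢a with i ≟ a
... | yes i≡a = ⊥-elim (i≢a i≡a)
... | no  _   = refl

interval : ℕ → ℕ → ℕ → ℕ
interval a b i with a ≤? i | i <? b
... | yes _ | yes _ = 1
... | _     | _     = 0

interval-inside : ∀ {a b i} → a ≤ i → i < b → interval a b i ≡ 1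
interval-inside {a} {b} {i} a≤i i<b with a ≤? i | i <? b
... | yes _   | yes _   = refl
... | no a≰i  | _       = ⊥-elim (a≰i a≤i)
... | yes _   | no i≮b  = ⊥-elim (i≮b i<b)

interval-below : ∀ {a b i} → ¬ a ≤ i → interval a b i ≡ 0
interval-below {a} {b} {i} a≰i with a ≤? i
... | yes a≤i = ⊥-elim (a≰i a≤i)
... | no _    = refl

interval-above : ∀ {a b i} → ¬ i < b → interval a b i ≡ 0
interval-above {a} {b} {i} i≮b with a ≤? i | i <? b
... | _     | yes i<b = ⊥-elim (i≮b i<b)
... | yes _ | no _    = refl
... | no _  | no _    = refl

interval≤1 : ∀ a b i → interval a b i ≤ 1
interval≤1 a b i with a ≤? i | i <? b
... | yes _ | yes _ = ≤-refl
... | yes _ | no _  = z≤n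
... | no _  | _     = z≤n

interval-bounds : ∀ {a b i} → 1 ≤ interval a b i → a ≤ i × i < b
interval-bounds {a} {b} {i} pos with a ≤? i | i <? b
... | yes a≤i | yes i<b = a≤i , i<b
... | yes _   | no _    = ⊥-elim (<-irrefl refl pos)
... | no _    | _       = ⊥-elim (<-irrefl refl pos)

sumTo-interval-cut : ∀ N a b → N ≤ b → sumTo N (interval a b) ≡ N ∸ a
sumTo-interval-cut zero    a b _ = sym (0∸n≡0 a)
sumTo-interval-cut (suc N) a b N<b = split (a ≤? N)
  where
  split : Dec (a ≤ N) → sumTo (suc N) (interval a b) ≡ suc N ∸ a
  split (yes a≤N) = trans (cong₂ _+_ (interval-inside a≤N N<b) (sumTo-interval-cut N a b (<⇒≤ N<b)))
                          (sym (+-∸-assoc 1 a≤N))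
  split (no a≰N)  = trans (cong₂ _+_ (interval-below a≰N) (sumTo-interval-cut N a b (<⇒≤ N<b)))
                          (trans (m≤n⇒m∸n≡0 (<⇒≤ (≰⇒> a≰N))) (sym (m≤n⇒m∸n≡0 (≰⇒> a≰N))))

sumTo-interval : ∀ N a b → b ≤ N → sumTo N (interval a b) ≡ b ∸ a
sumTo-interval zero    a zero    _ = sym (0∸n≡0 a)
sumTo-interval (suc N) a b b≤1+N = split (b ≟ suc N)
  where
  split : Dec (b ≡ suc N) → sumTo (suc N) (interval a b) ≡ b ∸ a
  split (yes refl)   = sumTo-interval-cut (suc N) a (suc N) ≤-refl
  split (no b≢1+N) = cong₂ _+_ (interval-above (λ N<b → b≢1+N (≤-antisym b≤1+N N<b)))
                               (sumTo-interval N a b (s≤s⁻¹ (≤∧≢⇒< b≤1+N b≢1+N)))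

excess : ℕ → (ℕ → ℕ) → ℕ
excess N C = sumTo N (λ k → C k ∸ 1)

excess-mono-≤ : ∀ N {C′ C : ℕ → ℕ} → (∀ k → C′ k ≤ C k) → excess N C′ ≤ excess N C
excess-mono-≤ N C′≤C = sumTo-mono-≤ N (λ k _ → ∸-monoˡ-≤ 1 (C′≤C k))

excess-drop : ∀ N {C′ C : ℕ → ℕ} {k a} → k < N → (∀ j → C′ j ≤ C j) → (C′ k ∸ 1) + a ≤ C k ∸ 1 →
  excess N C′ + a ≤ excess N C
excess-drop N k<N C′≤C = sumTo-drop N k<N (λ j → ∸-monoˡ-≤ 1 (C′≤C j))

pred-+1-≤ : ∀ {a c} → a ≤ c + 1 → a ∸ 1 ≤ (c ∸ 1) + 1
pred-+1-≤ {zero}          _         = z≤n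
pred-+1-≤ {suc a} {zero}  (s≤s a≤0) = ≤-trans a≤0 z≤n
pred-+1-≤ {suc a} {suc c} (s≤s a≤c) = a≤c

pred-drop₁ : ∀ {a c} → a + 1 ≤ c → 2 ≤ c → (a ∸ 1) + 1 ≤ c ∸ 1
pred-drop₁ {zero}  {suc zero}    _           (s≤s ())
pred-drop₁ {zero}  {suc (suc c)} _           _ = s≤s z≤n
pred-drop₁ {suc a} {suc c}       (s≤s a+1≤c) _ = a+1≤c

pred-drop₂ : ∀ {a c} → a + 2 ≤ c → 1 ≤ a → (a ∸ 1) + 2 ≤ c ∸ 1
pred-drop₂ {suc a} {suc c} (s≤s a+2≤c) _ = a+2≤c

balance-mono : ∀ {a b c d} → a + b ≡ c + d → d ≤ b → a ≤ c
balance-mono {a} {b} {c} {d} eq d≤b = +-cancelʳ-≤ b a c (≤-trans (≤-reflexive eq) (+-monoʳ-≤ c d≤b))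

balance-≤ : ∀ {a b c d e} → a + b ≡ c + d → d + e ≤ b → a + e ≤ c
balance-≤ {a} {b} {c} {d} {e} eq d+e≤b = +-cancelʳ-≤ d (a + e) c (begin
  a + e + d   ≡⟨ +-assoc a e d ⟩
  a + (e + d) ≡⟨ cong (a +_) (+-comm e d) ⟩
  a + (d + e) ≤⟨ +-monoʳ-≤ a d+e≤b ⟩
  a + b       ≡⟨ eq ⟩
  c + d       ∎)
  where open ≤-Reasoning

balance-gain : ∀ {a b c d} → a + b ≡ c + d → d ≤ 1 → a ≤ c + 1
balance-gain {a} {b} {c} eq d≤1 = ≤-trans (m≤m+n a b) (≤-trans (≤-reflexive eq) (+-monoʳ-≤ c d≤1))

module _ (N : ℕ) {C′ C : ℕ → ℕ} {x : ℕ} (x<N : x < N)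
         (C′≤C : ∀ j → j ≢ x → C′ j ≤ C j) (C′x≤Cx+1 : C′ x ≤ C x + 1) where

  private
    bound : ∀ j → C′ j ∸ 1 ≤ (C j ∸ 1) + point x j
    bound j = split (j ≟ x)
      where
      split : Dec (j ≡ x) → C′ j ∸ 1 ≤ (C j ∸ 1) + point x j
      split (yes refl) = subst (λ t → C′ x ∸ 1 ≤ (C x ∸ 1) + t) (sym (point-self x)) (pred-+1-≤ C′x≤Cx+1)
      split (no j≢x)   = subst (λ t → C′ j ∸ 1 ≤ (C j ∸ 1) + t) (sym (point-other j≢x))
                               (≤-trans (∸-monoˡ-≤ 1 (C′≤C j j≢x)) (m≤m+n _ 0))

    away : ∀ {k} → k ≢ x → (C k ∸ 1) + point x k ≡ C k ∸ 1
    away k≢x = trans (cong (_ +_) (point-other k≢x)) (+-identityʳ _)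

    bumped : sumTo N (λ j → (C j ∸ 1) + point x j) ≡ excess N C + 1
    bumped = trans (sumTo-+ N _ (point x))
                   (cong (excess N C +_) (trans (sumTo-concentrated N (point x) x<N (λ _ → point-other)) (point-self x)))

  excess-gain : excess N C′ ≤ excess N C + 1
  excess-gain = subst (excess N C′ ≤_) bumped (sumTo-mono-≤ N (λ j _ → bound j))

  excess-shift : ∀ {k a} → k < N → k ≢ x → (C′ k ∸ 1) + a ≤ C k ∸ 1 → excess N C′ + a ≤ excess N C + 1
  excess-shift {k} {a} k<N k≢x drop =
    subst (excess N C′ + a ≤_) bumped
          (sumTo-drop N k<N bound (subst ((C′ k ∸ 1) + a ≤_) (sym (away k≢x)) drop))

  excess-shift₂ : ∀ {k l a b} → k ≢ l → k < N → l < N → k ≢ x → l ≢ x →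
    (C′ k ∸ 1) + a ≤ C k ∸ 1 → (C′ l ∸ 1) + b ≤ C l ∸ 1 → excess N C′ + (a + b) ≤ excess N C + 1
  excess-shift₂ {k} {l} {a} {b} k≢l k<N l<N k≢x l≢x dropk dropl =
    subst (excess N C′ + (a + b) ≤_) bumped
          (sumTo-drop₂ N k≢l k<N l<N bound (subst ((C′ k ∸ 1) + a ≤_) (sym (away k≢x)) dropk)
                                           (subst ((C′ l ∸ 1) + b ≤_) (sym (away l≢x)) dropl))

excess≥1 : ∀ N (C : ℕ → ℕ) {k} → k < N → 2 ≤ C k → 1 ≤ excess N C
excess≥1 N C k<N 2≤Ck = ≤-trans (∸-monoˡ-≤ 1 2≤Ck) (term≤sumTo N (λ k → C k ∸ 1) k<N)

excess≥3 : ∀ N (C : ℕ → ℕ) {k l} → k ≢ l → k < N → l < N → 3 ≤ C k → 2 ≤ C l → 3 ≤ excess N C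
excess≥3 N C k≢l k<N l<N 3≤Ck 2≤Cl =
  ≤-trans (+-mono-≤ (∸-monoˡ-≤ 1 3≤Ck) (∸-monoˡ-≤ 1 2≤Cl)) (two-terms≤sumTo N (λ k → C k ∸ 1) k≢l k<N l<N)

gridSum : ℕ → (Vtx → ℕ) → ℕ
gridSum N f = sumTo N (λ i → sumTo N (λ j → f (i , j)))

InGrid : ℕ → Vtx → Set
InGrid N x = proj₁ x < N × proj₂ x < N

gridSum-cong : ∀ N {f g : Vtx → ℕ} → (∀ x → f x ≡ g x) → gridSum N f ≡ gridSum N g
gridSum-cong N f≡g = sumTo-cong N (λ i _ → sumTo-cong N (λ j _ → f≡g (i , j)))

gridSum-mono-≤ : ∀ N {f g : Vtx → ℕ} → (∀ x → InGrid N x → f x ≤ g x) → gridSum N f ≤ gridSum N g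
gridSum-mono-≤ N f≤g = sumTo-mono-≤ N (λ i i<N → sumTo-mono-≤ N (λ j j<N → f≤g (i , j) (i<N , j<N)))

gridSum-zeros : ∀ N → gridSum N (λ _ → 0) ≡ 0
gridSum-zeros N = sumTo-vanishing N (λ _ _ → sumTo-zeros N)

gridSum-+ : ∀ N (f g : Vtx → ℕ) → gridSum N (λ x → f x + g x) ≡ gridSum N f + gridSum N g
gridSum-+ N f g = trans (sumTo-cong N (λ i _ → sumTo-+ N (λ j → f (i , j)) (λ j → g (i , j))))
                        (sumTo-+ N (λ i → sumTo N (λ j → f (i , j))) (λ i → sumTo N (λ j → g (i , j))))

gridSum-concentrated : ∀ N (f : Vtx → ℕ) {a} → InGrid N a → (∀ x → x ≢ a → f x ≡ 0) → gridSum N f ≡ f a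
gridSum-concentrated N f {a₁ , a₂} (a₁<N , a₂<N) f≡0 =
  trans (sumTo-concentrated N (λ i → sumTo N (λ j → f (i , j))) a₁<N
          (λ i i≢a₁ → sumTo-vanishing N (λ j _ → f≡0 (i , j) (i≢a₁ ∘ cong proj₁))))
        (sumTo-concentrated N (λ j → f (a₁ , j)) a₂<N (λ j j≢a₂ → f≡0 (a₁ , j) (j≢a₂ ∘ cong proj₂)))

δ-self : ∀ v → δ v v ≡ 1
δ-self v with v ≟V v
... | yes _   = refl
... | no v≢v = ⊥-elim (v≢v refl)

δ-other : ∀ {x v} → x ≢ v → δ x v ≡ 0
δ-other {x} {v} x≢v with x ≟V v
... | yes x≡v = ⊥-elim (x≢v x≡v)
... | no _    = refl

δ≤1 : ∀ x v → δ x v ≤ 1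
δ≤1 x v with x ≟V v
... | yes _ = ≤-refl
... | no _  = z≤n

source-or-other : ∀ (z v w : Vtx) → (z ≡ v ⊎ z ≡ w) ⊎ (z ≢ v × z ≢ w)
source-or-other z v w with z ≟V v | z ≟V w
... | yes z≡v | _       = inj₁ (inj₁ z≡v)
... | no _    | yes z≡w = inj₁ (inj₂ z≡w)
... | no z≢v  | no z≢w  = inj₂ (z≢v , z≢w)

module _ (N : ℕ) (φ : Vtx → ℕ) where

  gridSum-*-+ : ∀ (f g : Vtx → ℕ) →
    gridSum N (λ x → φ x * (f x + g x)) ≡ gridSum N (λ x → φ x * f x) + gridSum N (λ x → φ x * g x)
  gridSum-*-+ f g = trans (gridSum-cong N (λ x → *-distribˡ-+ (φ x) (f x) (g x))) (gridSum-+ N _ _)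

  gridSum-*δ : ∀ {v} → InGrid N v → gridSum N (λ x → φ x * δ x v) ≡ φ v
  gridSum-*δ {v} v∈ =
    trans (gridSum-concentrated N _ v∈ (λ x x≢v → trans (cong (φ x *_) (δ-other x≢v)) (*-zeroʳ (φ x))))
          (trans (cong (φ v *_) (δ-self v)) (*-identityʳ (φ v)))

  gridSum-*δ₂ : ∀ {v w} → InGrid N v → InGrid N w → gridSum N (λ x → φ x * (δ x v + δ x w)) ≡ φ v + φ w
  gridSum-*δ₂ v∈ w∈ = trans (gridSum-*-+ _ _) (cong₂ _+_ (gridSum-*δ v∈) (gridSum-*δ w∈))

  gridSum-*-mono-≤ : ∀ {f g : Vtx → ℕ} → (∀ x → f x ≤ g x) → gridSum N (λ x → φ x * f x) ≤ gridSum N (λ x → φ x * g x)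
  gridSum-*-mono-≤ f≤g = gridSum-mono-≤ N (λ x _ → *-monoʳ-≤ (φ x) (f≤g x))

  gridSum-move : ∀ (p q : Dist) {v w u} → InGrid N v → InGrid N w → InGrid N u →
    (∀ x → q x + (δ x v + δ x w) ≡ p x + δ x u) →
    gridSum N (λ x → φ x * q x) + (φ v + φ w) ≡ gridSum N (λ x → φ x * p x) + φ u
  gridSum-move p q {v} {w} {u} v∈ w∈ u∈ q≡p = begin
    gridSum N (λ x → φ x * q x) + (φ v + φ w)
      ≡⟨ cong (_ +_) (gridSum-*δ₂ v∈ w∈) ⟨
    gridSum N (λ x → φ x * q x) + gridSum N (λ x → φ x * (δ x v + δ x w))
      ≡⟨ gridSum-*-+ q (λ x → δ x v + δ x w) ⟨
    gridSum N (λ x → φ x * (q x + (δ x v + δ x w)))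
      ≡⟨ gridSum-cong N (λ x → cong (φ x *_) (q≡p x)) ⟩
    gridSum N (λ x → φ x * (p x + δ x u))
      ≡⟨ gridSum-*-+ p (λ x → δ x u) ⟩
    gridSum N (λ x → φ x * p x) + gridSum N (λ x → φ x * δ x u)
      ≡⟨ cong (_ +_) (gridSum-*δ u∈) ⟩
    gridSum N (λ x → φ x * p x) + φ u
      ∎
    where open ≡-Reasoning

-- Lines of G_n

onLine : ℕ → Vtx → ℕ
onLine k (i , j) with k ≟ i | k ≟ j
... | yes _ | _     = 1
... | no _  | yes _ = 1
... | no _  | no _  = 0

onLine≤1 : ∀ k x → onLine k x ≤ 1
onLine≤1 k (i , j) with k ≟ i | k ≟ j
... | yes _ | _     = ≤-refl
... | no _  | yes _ = ≤-refl
... | no _  | no _  = z≤n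

onLine-fst : ∀ {k} x → proj₁ x ≡ k → onLine k x ≡ 1
onLine-fst {k} (i , j) i≡k with k ≟ i | k ≟ j
... | yes _  | _     = refl
... | no _   | yes _ = refl
... | no k≢i | no _  = ⊥-elim (k≢i (sym i≡k))

onLine-snd : ∀ {k} x → proj₂ x ≡ k → onLine k x ≡ 1
onLine-snd {k} (i , j) j≡k with k ≟ i | k ≟ j
... | yes _ | _      = refl
... | no _  | yes _  = refl
... | no _  | no k≢j = ⊥-elim (k≢j (sym j≡k))

onLine-outside : ∀ {k} x → k ≢ proj₁ x → k ≢ proj₂ x → onLine k x ≡ 0
onLine-outside {k} (i , j) k≢i k≢j with k ≟ i | k ≟ j
... | yes k≡i | _       = ⊥-elim (k≢i k≡i)
... | no _    | yes k≡j = ⊥-elim (k≢j k≡j)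
... | no _    | no _    = refl

onLine≡1⇒coordinate : ∀ {k} x → onLine k x ≡ 1 → k ≡ proj₁ x ⊎ k ≡ proj₂ x
onLine≡1⇒coordinate {k} (i , j) on with k ≟ i | k ≟ j
... | yes k≡i | _       = inj₁ k≡i
... | no _    | yes k≡j = inj₂ k≡j
... | no _    | no _    = ⊥-elim (0≢1+n on)

onLine-01 : ∀ k x → onLine k x ≡ 0 ⊎ onLine k x ≡ 1
onLine-01 k x with onLine k x | onLine≤1 k x
... | zero     | _ = inj₁ refl
... | suc zero | _ = inj₂ refl
... | suc (suc _) | s≤s ()

onLineOff₁ : ℕ → Vtx → ℕ
onLineOff₁ k x = (1 ∸ onLine 1 x) * onLine k x

onLineOff₁-on₁ : ∀ k {x} → onLine 1 x ≡ 1 → onLineOff₁ k x ≡ 0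
onLineOff₁-on₁ k on₁ rewrite on₁ = refl

onLineOff₁-off₁ : ∀ k {x} → onLine 1 x ≡ 0 → onLineOff₁ k x ≡ onLine k x
onLineOff₁-off₁ k {x} off₁ rewrite off₁ = +-identityʳ (onLine k x)

onLineOff₁-outside : ∀ {k x} → onLine k x ≡ 0 → onLineOff₁ k x ≡ 0
onLineOff₁-outside {k} {x} off rewrite off = *-zeroʳ (1 ∸ onLine 1 x)

onLineOff₁≤1 : ∀ k x → onLineOff₁ k x ≤ 1
onLineOff₁≤1 k x = *-mono-≤ (m∸n≤m 1 (onLine 1 x)) (onLine≤1 k x)

extra-diagonal : ∀ {s x y} → Extra s x y → ∃[ b ] ∃[ c ] (x ≡ (b , b) × y ≡ (c , c) × 2 ≤ b × 2 ≤ c)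
extra-diagonal (inj₁ (_ , t , 1≤t , _ , x≡ , y≡)) =
  2 * t + 1 , 2 * t , x≡ , y≡ , ≤-trans (*-monoʳ-≤ 2 1≤t) (m≤m+n (2 * t) 1) , *-monoʳ-≤ 2 1≤t
extra-diagonal (inj₂ (_ , t , 2≤t , _ , x≡ , y≡)) =
  2 * t , 2 * t ∸ 1 , x≡ , y≡ , *-monoʳ-≤ 2 (≤-trans (s≤s z≤n) 2≤t) ,
  ≤-trans (s≤s (s≤s z≤n)) (∸-monoˡ-≤ 1 (*-monoʳ-≤ 2 2≤t))

private
  parity-clash : ∀ {r} → r ≡ 1 → r ≡ 0 → ⊥
  parity-clash odd even = 0≢1+n (trans (sym even) odd)

  suc[2t∸1] : ∀ t → 1 ≤ t → suc (2 * t ∸ 1) ≡ 2 * t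
  suc[2t∸1] t 1≤t = m+[n∸m]≡n (≤-trans 1≤t (m≤m+n t (t + 0)))

  odd≢even : ∀ t t′ → 2 * t + 1 ≢ 2 * t′
  odd≢even t t′ eq = even≢odd t′ t (sym (trans (+-comm 1 (2 * t)) eq))

extra-target-injective : ∀ {s v w u} → Extra s v u → Extra s w u → v ≡ w
extra-target-injective (inj₁ (_ , t , _ , _ , refl , refl)) (inj₁ (_ , t′ , _ , _ , refl , u≡)) =
  cong (λ z → 2 * z + 1 , 2 * z + 1) (*-cancelˡ-≡ t t′ 2 (cong proj₁ u≡))
extra-target-injective (inj₂ (_ , t , 2≤t , _ , refl , refl)) (inj₂ (_ , t′ , 2≤t′ , _ , refl , u≡)) =
  cong (λ z → 2 * z , 2 * z) (*-cancelˡ-≡ t t′ 2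
    (trans (sym (suc[2t∸1] t (≤-trans (s≤s z≤n) 2≤t)))
           (trans (cong (suc ∘ proj₁) u≡) (suc[2t∸1] t′ (≤-trans (s≤s z≤n) 2≤t′)))))
extra-target-injective (inj₁ (odd , _))  (inj₂ (even , _)) = ⊥-elim (parity-clash odd even)
extra-target-injective (inj₂ (even , _)) (inj₁ (odd , _))  = ⊥-elim (parity-clash odd even)

extra-source-injective : ∀ {s u v w} → Extra s u v → Extra s u w → v ≡ w
extra-source-injective (inj₁ (_ , t , _ , _ , refl , refl)) (inj₁ (_ , t′ , _ , _ , u≡ , refl)) =
  cong (λ z → 2 * z , 2 * z) (*-cancelˡ-≡ t t′ 2 (+-cancelʳ-≡ 1 (2 * t) (2 * t′) (cong proj₁ u≡)))
extra-source-injective (inj₂ (_ , t , _ , _ , refl , refl)) (inj₂ (_ , t′ , _ , _ , u≡ , refl)) =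
  cong (λ z → 2 * z ∸ 1 , 2 * z ∸ 1) (*-cancelˡ-≡ t t′ 2 (cong proj₁ u≡))
extra-source-injective (inj₁ (odd , _))  (inj₂ (even , _)) = ⊥-elim (parity-clash odd even)
extra-source-injective (inj₂ (even , _)) (inj₁ (odd , _))  = ⊥-elim (parity-clash odd even)

extra-target-not-source : ∀ {s v u w} → Extra s v u → ¬ Extra s u w
extra-target-not-source (inj₁ (_ , t , _ , _ , _ , refl)) (inj₁ (_ , t′ , _ , _ , u≡ , _)) =
  odd≢even t′ t (sym (cong proj₁ u≡))
extra-target-not-source (inj₂ (_ , t , 2≤t , _ , _ , refl)) (inj₂ (_ , t′ , _ , _ , u≡ , _)) =
  even≢odd t t′ (trans (sym (suc[2t∸1] t (≤-trans (s≤s z≤n) 2≤t))) (cong (suc ∘ proj₁) u≡))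
extra-target-not-source (inj₁ (odd , _))  (inj₂ (even , _)) = ⊥-elim (parity-clash odd even)
extra-target-not-source (inj₂ (even , _)) (inj₁ (odd , _))  = ⊥-elim (parity-clash odd even)

extra-partner-unique : ∀ {s u v w} → Extra s v u ⊎ Extra s u v → Extra s w u ⊎ Extra s u w → v ≡ w
extra-partner-unique (inj₁ vu) (inj₁ wu) = extra-target-injective vu wu
extra-partner-unique (inj₁ vu) (inj₂ uw) = ⊥-elim (extra-target-not-source vu uw)
extra-partner-unique (inj₂ uv) (inj₁ wu) = ⊥-elim (extra-target-not-source wu uv)
extra-partner-unique (inj₂ uv) (inj₂ uw) = extra-source-injective uv uw

data AdjacencyKind (s : ℕ) (a u : Vtx) : Set where
  sameRow    : proj₁ a ≡ proj₁ u → AdjacencyKind s a u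
  sameColumn : proj₂ a ≡ proj₂ u → AdjacencyKind s a u
  extraEdge  : Extra s a u ⊎ Extra s u a → ∀ b c → a ≡ (b , b) → u ≡ (c , c) → 2 ≤ c → b ≢ c →
               AdjacencyKind s a u

adjacencyKind : ∀ {s a u} → AdjG s a u → AdjacencyKind s a u
adjacencyKind (_ , inj₁ same)        = sameRow same
adjacencyKind (_ , inj₂ (inj₁ same)) = sameColumn same
adjacencyKind (a≢u , inj₂ (inj₂ (inj₁ au))) with extra-diagonal au
... | b , c , a≡ , u≡ , _ , 2≤c =
  extraEdge (inj₁ au) b c a≡ u≡ 2≤c (λ b≡c → a≢u (trans a≡ (trans (cong (λ z → z , z) b≡c) (sym u≡))))
adjacencyKind (a≢u , inj₂ (inj₂ (inj₂ ua))) with extra-diagonal ua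
... | c , b , u≡ , a≡ , 2≤c , _ =
  extraEdge (inj₂ ua) b c a≡ u≡ 2≤c (λ b≡c → a≢u (trans a≡ (trans (cong (λ z → z , z) b≡c) (sym u≡))))

vertex-inGrid : ∀ {n s} x → VertexG n s x → InGrid (suc s) x
vertex-inGrid (i , j) (inj₁ (_ , i≤j , j≤s , _)) = s≤s (≤-trans i≤j j≤s) , s≤s j≤s
vertex-inGrid (i , j) (inj₂ (refl , j≤s , _))   = s≤s z≤n , s≤s j≤s

adjacent-to-corner-onLine₁ : ∀ {s v} → AdjG s v (1 , 1) → onLine 1 v ≡ 1
adjacent-to-corner-onLine₁ {v = v} adj with adjacencyKind adj
... | sameRow same    = onLine-fst v same
... | sameColumn same = onLine-snd v same
... | extraEdge _ _ _ _ u≡ 2≤c _ = ⊥-elim (<-irrefl (cong proj₁ u≡) 2≤c)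

-- For u = (1 , j) or u = (i , 1), the coordinate of u other than 1.
otherLine : Vtx → ℕ
otherLine u = proj₁ u + proj₂ u ∸ 1

otherLine<1+s : ∀ {n s} u → VertexG n s u → onLine 1 u ≡ 1 → otherLine u < suc s
otherLine<1+s {s = s} (i , j) u∈ on₁ with vertex-inGrid (i , j) u∈ | onLine≡1⇒coordinate (i , j) on₁
... | _   , j<  | inj₁ refl = j<
... | i<  , _   | inj₂ refl = subst (_< suc s) (sym (m+n∸n≡m i 1)) i<

adjacent-onOtherLine : ∀ {n s u v} → VertexG n s u → onLine 1 u ≡ 1 → u ≢ (1 , 1) → onLine 1 v ≡ 0 →
  AdjG s v u → onLine (otherLine u) v ≡ 1
adjacent-onOtherLine {u = i , j} {v} u∈ on₁ u≢11 off₁ adj with onLine≡1⇒coordinate (i , j) on₁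
adjacent-onOtherLine {u = .1 , j} {v} u∈ on₁ u≢11 off₁ adj | inj₁ refl with adjacencyKind adj
... | sameRow same    = ⊥-elim (0≢1+n (trans (sym off₁) (onLine-fst v same)))
... | sameColumn same = onLine-snd v same
... | extraEdge _ _ _ _ u≡ _ _ = ⊥-elim (u≢11 (cong (1 ,_) (trans (cong proj₂ u≡) (sym (cong proj₁ u≡)))))
adjacent-onOtherLine {u = i , .1} (inj₁ (1≤i , i≤1 , _)) on₁ u≢11 off₁ adj | inj₂ refl =
  ⊥-elim (u≢11 (cong (_, 1) (≤-antisym i≤1 1≤i)))
adjacent-onOtherLine {u = .0 , .1} {v} (inj₂ (refl , _)) on₁ u≢11 off₁ adj | inj₂ refl with adjacencyKind adj
... | sameRow same    = onLine-fst v same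
... | sameColumn same = ⊥-elim (0≢1+n (trans (sym off₁) (onLine-snd v same)))
... | extraEdge _ _ _ _ u≡ 2≤c _ = ⊥-elim (<-irrefl (cong proj₁ u≡) (≤-trans (s≤s z≤n) 2≤c))

onLine-≤ : ∀ {k} u {m} → (k ≡ proj₁ u → 1 ≤ m) → (k ≡ proj₂ u → 1 ≤ m) → onLine k u ≤ m
onLine-≤ {k} u viaFst viaSnd with onLine-01 k u
... | inj₁ off = subst (_≤ _) (sym off) z≤n
... | inj₂ on with onLine≡1⇒coordinate u on
...   | inj₁ k≡i = ≤-trans (onLine≤1 k u) (viaFst k≡i)
...   | inj₂ k≡j = ≤-trans (onLine≤1 k u) (viaSnd k≡j)

Covers : Vtx → Vtx → Vtx → ℕ → Set
Covers u v w k = onLine k u ≤ onLine k v + onLine k w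

data LineCover (s : ℕ) (u v w : Vtx) : Set where
  covered : (∀ k → Covers u v w k) → LineCover s u v w
  shifted : ∀ k₀ x → k₀ ≢ x → k₀ < suc s → x < suc s → onLine k₀ v + onLine k₀ w ≡ 2 →
            (∀ k → k ≢ x → Covers u v w k) → LineCover s u v w

lineCover : ∀ {s u v w} → InGrid (suc s) u → InGrid (suc s) v → AdjG s v u → AdjG s w u → LineCover s u v w
lineCover {s} {u} {v} {w} u∈ v∈ vu wu = cover (adjacencyKind vu) (adjacencyKind wu)
  where
  viaRow : ∀ {a k} → proj₁ a ≡ proj₁ u → k ≡ proj₁ u → onLine k a ≡ 1
  viaRow {a} same k≡i = onLine-fst a (trans same (sym k≡i))

  viaColumn : ∀ {a k} → proj₂ a ≡ proj₂ u → k ≡ proj₂ u → onLine k a ≡ 1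
  viaColumn {a} same k≡j = onLine-snd a (trans same (sym k≡j))

  viaRowOfDiagonal : ∀ {a k c} → proj₁ a ≡ proj₁ u → u ≡ (c , c) → k ≡ proj₂ u → onLine k a ≡ 1
  viaRowOfDiagonal same u≡ k≡j = viaRow same (trans k≡j (trans (cong proj₂ u≡) (sym (cong proj₁ u≡))))

  viaColumnOfDiagonal : ∀ {a k c} → proj₂ a ≡ proj₂ u → u ≡ (c , c) → k ≡ proj₁ u → onLine k a ≡ 1
  viaColumnOfDiagonal same u≡ k≡i = viaColumn same (trans k≡i (trans (cong proj₁ u≡) (sym (cong proj₂ u≡))))

  hitV : ∀ {k} → onLine k v ≡ 1 → 1 ≤ onLine k v + onLine k w
  hitV on = subst (λ t → 1 ≤ t + _) (sym on) (s≤s z≤n)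

  hitW : ∀ {k} → onLine k w ≡ 1 → 1 ≤ onLine k v + onLine k w
  hitW on = subst (λ t → 1 ≤ _ + t) (sym on) (m≤n+m 1 _)

  cover : AdjacencyKind s v u → AdjacencyKind s w u → LineCover s u v w
  cover (sameRow e₁) (sameRow e₂) with proj₁ u ≟ proj₂ u
  ... | yes i≡j = covered (λ k → onLine-≤ u (hitV ∘ viaRow e₁) (λ k≡j → hitV (viaRow e₁ (trans k≡j (sym i≡j)))))
  ... | no i≢j  = shifted (proj₁ u) (proj₂ u) i≢j (proj₁ u∈) (proj₂ u∈) (cong₂ _+_ (viaRow e₁ refl) (viaRow e₂ refl))
                          (λ k k≢j → onLine-≤ u (hitV ∘ viaRow e₁) (⊥-elim ∘ k≢j))
  cover (sameColumn e₁) (sameColumn e₂) with proj₂ u ≟ proj₁ u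
  ... | yes j≡i = covered (λ k → onLine-≤ u (λ k≡i → hitV (viaColumn e₁ (trans k≡i (sym j≡i)))) (hitV ∘ viaColumn e₁))
  ... | no j≢i  = shifted (proj₂ u) (proj₁ u) j≢i (proj₂ u∈) (proj₁ u∈) (cong₂ _+_ (viaColumn e₁ refl) (viaColumn e₂ refl))
                          (λ k k≢i → onLine-≤ u (⊥-elim ∘ k≢i) (hitV ∘ viaColumn e₁))
  cover (sameRow e₁)    (sameColumn e₂) = covered (λ k → onLine-≤ u (hitV ∘ viaRow e₁) (hitW ∘ viaColumn e₂))
  cover (sameColumn e₁) (sameRow e₂)    = covered (λ k → onLine-≤ u (hitW ∘ viaRow e₂) (hitV ∘ viaColumn e₁))
  cover (extraEdge _ _ _ _ u≡ _ _) (sameRow e₂) =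
    covered (λ k → onLine-≤ u (hitW ∘ viaRow e₂) (hitW ∘ viaRowOfDiagonal e₂ u≡))
  cover (extraEdge _ _ _ _ u≡ _ _) (sameColumn e₂) =
    covered (λ k → onLine-≤ u (hitW ∘ viaColumnOfDiagonal e₂ u≡) (hitW ∘ viaColumn e₂))
  cover (sameRow e₁) (extraEdge _ _ _ _ u≡ _ _) =
    covered (λ k → onLine-≤ u (hitV ∘ viaRow e₁) (hitV ∘ viaRowOfDiagonal e₁ u≡))
  cover (sameColumn e₁) (extraEdge _ _ _ _ u≡ _ _) =
    covered (λ k → onLine-≤ u (hitV ∘ viaColumnOfDiagonal e₁ u≡) (hitV ∘ viaColumn e₁))
  cover (extraEdge vu′ b c v≡ u≡ _ b≢c) (extraEdge wu′ _ _ _ _ _ _) with extra-partner-unique vu′ wu′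
  ... | refl = shifted b c b≢c (subst (_< suc s) (cong proj₁ v≡) (proj₁ v∈)) (subst (_< suc s) (cong proj₁ u≡) (proj₁ u∈))
                 (cong₂ _+_ (onLine-fst v (cong proj₁ v≡)) (onLine-fst v (cong proj₁ v≡)))
                 (λ k k≢c → onLine-≤ u (λ k≡ → ⊥-elim (k≢c (trans k≡ (cong proj₁ u≡))))
                                       (λ k≡ → ⊥-elim (k≢c (trans k≡ (cong proj₂ u≡)))))

adjacent-covers-but-one : ∀ {s u b} → InGrid (suc s) u → AdjG s b u →
  ∃[ x ] (x < suc s × ∀ k → k ≢ x → onLine k u ≤ onLine k b)
adjacent-covers-but-one {s} {u} {b} u∈ adj with adjacencyKind adj
... | sameRow same    = proj₂ u , proj₂ u∈ , λ k k≢j →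
        onLine-≤ u (λ k≡i → ≤-reflexive (sym (onLine-fst b (trans same (sym k≡i))))) (⊥-elim ∘ k≢j)
... | sameColumn same = proj₁ u , proj₁ u∈ , λ k k≢i →
        onLine-≤ u (⊥-elim ∘ k≢i) (λ k≡j → ≤-reflexive (sym (onLine-snd b (trans same (sym k≡j)))))
... | extraEdge _ _ c _ u≡ _ _ = c , subst (_< suc s) (cong proj₁ u≡) (proj₁ u∈) , λ k k≢c →
        onLine-≤ u (λ k≡ → ⊥-elim (k≢c (trans k≡ (cong proj₁ u≡)))) (λ k≡ → ⊥-elim (k≢c (trans k≡ (cong proj₂ u≡))))

-- The blocking invariant

load : ℕ → Dist → ℕ → ℕ
load s p k = gridSum (suc s) (λ x → onLineOff₁ k x * p x)

load₁ : ℕ → Dist → ℕ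
load₁ s p = gridSum (suc s) (λ x → onLine 1 x * p x)

excessOf : ℕ → Dist → ℕ
excessOf s p = excess (suc s) (load s p)

Hub : ℕ → Dist → Set
Hub s p = ∃[ z ] (onLine 1 z ≡ 0 × InGrid (suc s) z × 1 ≤ p z × (∀ k → 2 ≤ load s p k → onLine k z ≡ 1))

Blocked : ℕ → Dist → Set
Blocked s p = p (1 , 1) ≡ 0 × excessOf s p + 2 * load₁ s p ≤ 2 × (excessOf s p ≡ 2 → Hub s p)

load-beyond : ∀ s p {k} → suc s ≤ k → load s p k ≡ 0
load-beyond s p {k} 1+s≤k = n≤0⇒n≡0 (≤-trans (gridSum-mono-≤ (suc s) off-grid) (≤-reflexive (gridSum-zeros (suc s))))
  where
  off-grid : ∀ x → InGrid (suc s) x → onLineOff₁ k x * p x ≤ 0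
  off-grid x (i< , j<) = ≤-reflexive (cong (_* p x) (onLineOff₁-outside (onLine-outside x
    (λ k≡i → <-irrefl refl (≤-trans (subst (_< suc s) (sym k≡i) i<) 1+s≤k))
    (λ k≡j → <-irrefl refl (≤-trans (subst (_< suc s) (sym k≡j) j<) 1+s≤k)))))

load-positive⇒line<1+s : ∀ s p {k} → 1 ≤ load s p k → k < suc s
load-positive⇒line<1+s s p {k} pos with k <? suc s
... | yes k< = k<
... | no k≮  = ⊥-elim (<-irrefl refl (≤-trans pos (≤-reflexive (load-beyond s p (≮⇒≥ k≮)))))

record MoveEffect (s : ℕ) (p q : Dist) (v w u : Vtx) : Set where
  field
    target∈            : InGrid (suc s) u
    load-step          : ∀ k → load s q k + (onLineOff₁ k v + onLineOff₁ k w) ≡ load s p k + onLineOff₁ k u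
    load₁-step         : load₁ s q + (onLine 1 v + onLine 1 w) ≡ load₁ s p + onLine 1 u
    sources≤load       : ∀ k → onLineOff₁ k v + onLineOff₁ k w ≤ load s p k
    sources≤load₁      : onLine 1 v + onLine 1 w ≤ load₁ s p
    sources+other≤load : ∀ z → z ≢ v → z ≢ w → InGrid (suc s) z → 1 ≤ p z →
                         ∀ k → onLineOff₁ k v + onLineOff₁ k w + onLineOff₁ k z ≤ load s p k
    target-pebbled     : 1 ≤ q u
    corner-stays-empty : u ≢ (1 , 1) → p (1 , 1) ≡ 0 → q (1 , 1) ≡ 0
    emptied⇒source     : ∀ z → q z ≡ 0 → 1 ≤ p z → z ≡ v ⊎ z ≡ w

moveEffect : ∀ {s} {p q : Dist} {v w u} → InGrid (suc s) v → InGrid (suc s) w → InGrid (suc s) u →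
  v ≢ u → w ≢ u → (∀ x → q x + (δ x v + δ x w) ≡ p x + δ x u) → MoveEffect s p q v w u
moveEffect {s} {p} {q} {v} {w} {u} v∈ w∈ u∈ v≢u w≢u q≡p = record
  { target∈            = u∈
  ; load-step          = λ k → gridSum-move N (onLineOff₁ k) p q v∈ w∈ u∈ q≡p
  ; load₁-step         = gridSum-move N (onLine 1) p q v∈ w∈ u∈ q≡p
  ; sources≤load       = λ k → weight≤ (onLineOff₁ k) sources≤p
  ; sources≤load₁      = weight≤ (onLine 1) sources≤p
  ; sources+other≤load = λ z z≢v z≢w z∈ pz k → subst (_≤ load s p k)
                           (trans (gridSum-*-+ N (onLineOff₁ k) _ (λ x → δ x z))
                                  (cong₂ _+_ (gridSum-*δ₂ N (onLineOff₁ k) v∈ w∈) (gridSum-*δ N (onLineOff₁ k) z∈)))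
                           (gridSum-*-mono-≤ N (onLineOff₁ k) (three≤p z≢v z≢w pz))
  ; target-pebbled     = subst (1 ≤_) (sym q[u]) (s≤s z≤n)
  ; corner-stays-empty = λ u≢11 p11 → m+n≡0⇒m≡0 (q (1 , 1))
                           (trans (q≡p (1 , 1)) (cong₂ _+_ p11 (δ-other (u≢11 ∘ sym))))
  ; emptied⇒source     = emptied
  }
  where
  N = suc s
  sources-at-u : δ u v + δ u w ≡ 0
  sources-at-u = cong₂ _+_ (δ-other (v≢u ∘ sym)) (δ-other (w≢u ∘ sym))

  q[u] : q u ≡ 1 + p u
  q[u] = trans (sym (+-identityʳ (q u)))
        (trans (cong (q u +_) (sym sources-at-u)) (trans (q≡p u) (trans (cong (p u +_) (δ-self u)) (+-comm (p u) 1))))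

  sources≤p : ∀ x → δ x v + δ x w ≤ p x
  sources≤p x = split (x ≟V u)
    where
    split : Dec (x ≡ u) → δ x v + δ x w ≤ p x
    split (yes refl) = subst (_≤ p u) (sym sources-at-u) z≤n
    split (no x≢u)   = ≤-trans (m≤n+m _ (q x))
                         (≤-reflexive (trans (q≡p x) (trans (cong (p x +_) (δ-other x≢u)) (+-identityʳ (p x)))))

  three≤p : ∀ {z} → z ≢ v → z ≢ w → 1 ≤ p z → ∀ x → δ x v + δ x w + δ x z ≤ p x
  three≤p {z} z≢v z≢w pz x = split (x ≟V z)
    where
    split : Dec (x ≡ z) → δ x v + δ x w + δ x z ≤ p x
    split (yes refl) = subst (λ t → t + δ z z ≤ p z) (sym (cong₂ _+_ (δ-other z≢v) (δ-other z≢w))) (≤-trans (δ≤1 z z) pz)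
    split (no x≢z)   = subst (_≤ p x) (sym (trans (cong (_ +_) (δ-other x≢z)) (+-identityʳ _))) (sources≤p x)

  weight≤ : ∀ φ → (∀ x → δ x v + δ x w ≤ p x) → φ v + φ w ≤ gridSum N (λ x → φ x * p x)
  weight≤ φ r≤p = subst (_≤ gridSum N (λ x → φ x * p x)) (gridSum-*δ₂ N φ v∈ w∈) (gridSum-*-mono-≤ N φ r≤p)

  emptied : ∀ z → q z ≡ 0 → 1 ≤ p z → z ≡ v ⊎ z ≡ w
  emptied z qz≡0 pz with source-or-other z v w
  ... | inj₁ source          = source
  ... | inj₂ (z≢v , z≢w)     = ⊥-elim (<-irrefl refl (≤-trans pz (≤-trans (m≤m+n (p z) (δ z u))
      (≤-reflexive (trans (sym (q≡p z)) (cong₂ _+_ qz≡0 (cong₂ _+_ (δ-other z≢v) (δ-other z≢w))))))))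

module Step {s} {p q : Dist} {v w u} (effect : MoveEffect s p q v w u) where
  open MoveEffect effect

  private
    N = suc s
    C  = load s p
    C′ = load s q
    X  = excessOf s p
    X′ = excessOf s q

    excess≤2 : Blocked s p → X ≤ 2
    excess≤2 (_ , bound , _) = ≤-trans (m≤m+n X _) bound

    over-budget : ∀ {d e} → X′ ≡ 2 → X ≤ 2 → X′ + d ≤ X + e → e < d → ⊥
    over-budget {d} {e} X′≡2 X≤2 le e<d =
      <-irrefl refl (≤-trans (+-monoʳ-≤ 2 e<d) (≤-trans (subst (λ t → t + d ≤ X + e) X′≡2 le) (+-monoˡ-≤ e X≤2)))

    source-hit : ∀ {k z} → z ≡ v ⊎ z ≡ w → onLine k z ≡ 1 → 1 ≤ onLine k v + onLine k w
    source-hit {k} (inj₁ refl) on = subst (λ t → 1 ≤ t + onLine k w) (sym on) (s≤s z≤n)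
    source-hit {k} (inj₂ refl) on = subst (λ t → 1 ≤ onLine k v + t) (sym on) (m≤n+m 1 (onLine k v))

  both-sources-on-line₁ : onLine 1 v ≡ 1 → onLine 1 w ≡ 1 → ¬ Blocked s p
  both-sources-on-line₁ v-on w-on (_ , bound , _) =
    4≰2 (≤-trans (*-monoʳ-≤ 2 2≤L) (≤-trans (m≤n+m _ X) bound))
    where
    4≰2 : ¬ 4 ≤ 2
    4≰2 (s≤s (s≤s ()))

    2≤L : 2 ≤ load₁ s p
    2≤L = subst (_≤ load₁ s p) (cong₂ _+_ v-on w-on) sources≤load₁

  -- When one source lies on line 1, the budget forces load₁ = 1 and excess 0 before the move.
  module OneSourceOnLine₁ {b} (b-off : onLine 1 b ≡ 0) (bu : AdjG s b u)
      (spent≡ : ∀ k → onLineOff₁ k v + onLineOff₁ k w ≡ onLine k b) (spent₁≡ : onLine 1 v + onLine 1 w ≡ 1)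
      (blocked : Blocked s p) where

    private
      bound : X + 2 * load₁ s p ≤ 2
      bound = proj₁ (proj₂ blocked)

      1≤L : 1 ≤ load₁ s p
      1≤L = subst (_≤ load₁ s p) spent₁≡ sources≤load₁

      X≡0 : X ≡ 0
      X≡0 = n≤0⇒n≡0 (+-cancelʳ-≤ 2 X 0 (≤-trans (+-monoʳ-≤ X (*-monoʳ-≤ 2 1≤L)) bound))

      L≡1 : load₁ s p ≡ 1
      L≡1 = ≤-antisym (*-cancelˡ-≤ 2 (≤-trans (m≤n+m _ X) bound)) 1≤L

      balance : ∀ k → C′ k + onLine k b ≡ C k + onLineOff₁ k u
      balance k = subst (λ t → C′ k + t ≡ C k + onLineOff₁ k u) (spent≡ k) (load-step k)

      balance₁ : load₁ s q + 1 ≡ load₁ s p + onLine 1 u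
      balance₁ = subst (λ t → load₁ s q + t ≡ load₁ s p + onLine 1 u) spent₁≡ load₁-step

    target-on-line₁ : onLine 1 u ≡ 1 → Blocked s q
    target-on-line₁ u-on = corner-stays-empty u≢11 (proj₁ blocked) , ≤-reflexive (cong₂ (λ a l → a + 2 * l) X′≡0 L′≡1) ,
                           λ X′≡2 → ⊥-elim (0≢1+n (trans (sym X′≡0) X′≡2))
      where
      u≢11 : u ≢ (1 , 1)
      u≢11 u≡11 = 0≢1+n (trans (sym b-off) (adjacent-to-corner-onLine₁ (subst (AdjG s b) u≡11 bu)))

      X′≡0 : X′ ≡ 0
      X′≡0 = n≤0⇒n≡0 (subst (X′ ≤_) X≡0 (excess-mono-≤ N {C′} {C} (λ k →
               balance-mono (trans (balance k) (cong (C k +_) (onLineOff₁-on₁ k u-on))) z≤n)))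

      L′≡1 : load₁ s q ≡ 1
      L′≡1 = +-cancelʳ-≡ 1 (load₁ s q) 1 (trans balance₁ (cong₂ _+_ L≡1 u-on))

    target-off-line₁ : onLine 1 u ≡ 0 → Blocked s q
    target-off-line₁ u-off = corner-stays-empty u≢11 (proj₁ blocked) ,
                             subst (λ l → X′ + 2 * l ≤ 2) (sym L′≡0) (≤-trans (≤-reflexive (+-identityʳ X′)) (m≤n⇒m≤1+n X′≤1)) ,
                             λ X′≡2 → ⊥-elim (<-irrefl refl (subst (_≤ 1) X′≡2 X′≤1))
      where
      u≢11 : u ≢ (1 , 1)
      u≢11 u≡11 = 0≢1+n (trans (sym u-off) (onLine-fst u (cong proj₁ u≡11)))

      L′≡0 : load₁ s q ≡ 0
      L′≡0 = +-cancelʳ-≡ 1 (load₁ s q) 0 (trans balance₁ (cong₂ _+_ L≡1 u-off))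

      balance′ : ∀ k → C′ k + onLine k b ≡ C k + onLine k u
      balance′ k = trans (balance k) (cong (C k +_) (onLineOff₁-off₁ k u-off))

      X′≤1 : X′ ≤ 1
      X′≤1 with adjacent-covers-but-one target∈ bu
      ... | x , x<N , covers = subst (λ t → X′ ≤ t + 1) X≡0
              (excess-gain N {C′} {C} x<N (λ j j≢x → balance-mono (balance′ j) (covers j j≢x))
                                 (balance-gain (balance′ x) (onLine≤1 x u)))

    preserved : Blocked s q
    preserved with onLine-01 1 u
    ... | inj₁ u-off = target-off-line₁ u-off
    ... | inj₂ u-on  = target-on-line₁ u-on

  -- Both sources lie on the line K through the target, so the move spends two pebbles of load K.
  module TargetEntersLine₁ (v-off : onLine 1 v ≡ 0) (w-off : onLine 1 w ≡ 0) (u-on : onLine 1 u ≡ 1)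
      (u≢11 : u ≢ (1 , 1)) {K} (K<N : K < N) (v-onK : onLine K v ≡ 1) (w-onK : onLine K w ≡ 1)
      (blocked : Blocked s p) where

    private
      spent≡ : ∀ k → onLineOff₁ k v + onLineOff₁ k w ≡ onLine k v + onLine k w
      spent≡ k = cong₂ _+_ (onLineOff₁-off₁ k v-off) (onLineOff₁-off₁ k w-off)

      balance : ∀ k → C′ k + (onLine k v + onLine k w) ≡ C k + 0
      balance k = subst₂ (λ a b → C′ k + a ≡ C k + b) (spent≡ k) (onLineOff₁-on₁ k u-on) (load-step k)

      C′≤C : ∀ k → C′ k ≤ C k
      C′≤C k = balance-mono (balance k) z≤n

      spentK : onLine K v + onLine K w ≡ 2
      spentK = cong₂ _+_ v-onK w-onK

      2≤CK : 2 ≤ C K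
      2≤CK = subst (_≤ C K) (trans (spent≡ K) spentK) (sources≤load K)

      C′K+2≡CK : C′ K + 2 ≡ C K
      C′K+2≡CK = trans (subst (λ t → C′ K + t ≡ C K + 0) spentK (balance K)) (+-identityʳ (C K))

      X≤2 : X ≤ 2
      X≤2 = excess≤2 blocked

      L≡0 : load₁ s p ≡ 0
      L≡0 = n≤0⇒n≡0 (≮⇒≥ λ 0<L → <-irrefl refl
              (≤-trans (+-mono-≤ (excess≥1 N C K<N 2≤CK) (*-monoʳ-≤ 2 0<L)) (proj₁ (proj₂ blocked))))

      L′≡1 : load₁ s q ≡ 1
      L′≡1 = trans (sym (+-identityʳ (load₁ s q))) (trans (cong (load₁ s q +_) (sym (cong₂ _+_ v-off w-off)))
                                                         (trans load₁-step (cong₂ _+_ L≡0 u-on)))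

      -- With excess 2 and load exactly 2 on K, the hub is one of the sources and meets every loaded line.
      drained : Hub s p → C K ≡ 2 → ∀ j → j < N → C′ j ≤ 1
      drained (z , z-off , z∈ , pz , z-hub) CK≡2 j j<N with 2 ≤? C j
      ... | no  C≱2 = ≤-trans (C′≤C j) (≤-pred (≰⇒> C≱2))
      ... | yes 2≤C = +-cancelʳ-≤ 1 (C′ j) 1
                        (≤-trans (balance-≤ (balance j) (source-hit z-source (z-hub j 2≤C))) Cj≤2)
        where
        z-source : z ≡ v ⊎ z ≡ w
        z-source with source-or-other z v w
        ... | inj₁ src            = src
        ... | inj₂ (z≢v , z≢w)    = ⊥-elim (<-irrefl (sym CK≡2) (subst (_≤ C K)
                (cong₂ _+_ (trans (spent≡ K) spentK) (trans (onLineOff₁-off₁ K z-off) (z-hub K 2≤CK)))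
                (sources+other≤load z z≢v z≢w z∈ pz K)))

        Cj≤2 : C j ≤ 2
        Cj≤2 with 3 ≤? C j
        ... | no  C≱3 = ≤-pred (≰⇒> C≱3)
        ... | yes 3≤C = ⊥-elim (<-irrefl refl (≤-trans (excess≥3 N C j≢K j<N K<N 3≤C 2≤CK) X≤2))
          where
          j≢K : j ≢ K
          j≢K refl = <-irrefl (sym CK≡2) 3≤C

      X′≡0 : X′ ≡ 0
      X′≡0 with X ≟ 2
      ... | no X≢2 = n≤0⇒n≡0 (+-cancelʳ-≤ 1 X′ 0 (≤-trans
                       (excess-drop N K<N C′≤C (pred-drop₁ (≤-trans (+-monoʳ-≤ (C′ K) (s≤s z≤n)) (≤-reflexive C′K+2≡CK)) 2≤CK))
                       (≤-pred (≤∧≢⇒< X≤2 X≢2))))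
      ... | yes X≡2 with 3 ≤? C K
      ...   | yes 3≤CK = n≤0⇒n≡0 (+-cancelʳ-≤ 2 X′ 0 (≤-trans
                           (excess-drop N K<N C′≤C (pred-drop₂ (≤-reflexive C′K+2≡CK)
                              (+-cancelʳ-≤ 2 1 (C′ K) (≤-trans 3≤CK (≤-reflexive (sym C′K+2≡CK))))))
                           (≤-reflexive X≡2)))
      ...   | no  C≱3  = sumTo-vanishing N (λ j j<N → m≤n⇒m∸n≡0 (drained (proj₂ (proj₂ blocked) X≡2)
                           (≤-antisym (≤-pred (≰⇒> C≱3)) 2≤CK) j j<N))

    preserved : Blocked s q
    preserved = corner-stays-empty u≢11 (proj₁ blocked) , ≤-reflexive (cong₂ (λ a l → a + 2 * l) X′≡0 L′≡1) ,
                λ X′≡2 → ⊥-elim (0≢1+n (trans (sym X′≡0) X′≡2))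

  module OffLine₁ (v-off : onLine 1 v ≡ 0) (w-off : onLine 1 w ≡ 0) (u-off : onLine 1 u ≡ 0)
      (blocked : Blocked s p) where

    private
      spent : ℕ → ℕ
      spent k = onLine k v + onLine k w

      balance : ∀ k → C′ k + spent k ≡ C k + onLine k u
      balance k = subst₂ (λ a b → C′ k + a ≡ C k + b)
                         (cong₂ _+_ (onLineOff₁-off₁ k v-off) (onLineOff₁-off₁ k w-off)) (onLineOff₁-off₁ k u-off)
                         (load-step k)

      spent≤C : ∀ k → spent k ≤ C k
      spent≤C k = subst (_≤ C k) (cong₂ _+_ (onLineOff₁-off₁ k v-off) (onLineOff₁-off₁ k w-off)) (sources≤load k)

      C′≤C : ∀ {k} → Covers u v w k → C′ k ≤ C k
      C′≤C {k} cov = balance-mono (balance k) cov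

      C′≤C+1 : ∀ k → C′ k ≤ C k + 1
      C′≤C+1 k = balance-gain (balance k) (onLine≤1 k u)

      drop-where-spent-twice : ∀ {k} → spent k ≡ 2 → (C′ k ∸ 1) + 1 ≤ C k ∸ 1
      drop-where-spent-twice {k} twice =
        pred-drop₁ {C′ k} {C k} (balance-≤ (balance k) (subst (onLine k u + 1 ≤_) (sym twice) (+-monoˡ-≤ 1 (onLine≤1 k u))))
                   (subst (_≤ C k) twice (spent≤C k))

      drop-where-not-gained : ∀ {k} → onLine k u ≡ 0 → 1 ≤ spent k → C′ k + 1 ≤ C k
      drop-where-not-gained {k} off hit = balance-≤ (balance k) (subst (λ t → t + 1 ≤ spent k) (sym off) hit)

      X≤2 : X ≤ 2
      X≤2 = excess≤2 blocked

      L′≡L : load₁ s q ≡ load₁ s p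
      L′≡L = trans (sym (+-identityʳ _)) (trans (subst₂ (λ a b → load₁ s q + a ≡ load₁ s p + b)
                                                         (cong₂ _+_ v-off w-off) u-off load₁-step) (+-identityʳ _))

    excess-nonincreasing : LineCover s u v w → X′ ≤ X
    excess-nonincreasing (covered cov) = excess-mono-≤ N {C′} {C} (λ k → C′≤C (cov k))
    excess-nonincreasing (shifted k₀ x k₀≢x k₀<N x<N twice cov) =
      +-cancelʳ-≤ 1 X′ X (excess-shift N {C′} {C} x<N (λ j j≢x → C′≤C (cov j j≢x)) (C′≤C+1 x) k₀<N k₀≢x (drop-where-spent-twice twice))

    -- If the hub empties it was a source, and then the target takes over its role.
    hub-if-covered : (∀ k → Covers u v w k) → X′ ≡ 2 → Hub s p → Hub s q
    hub-if-covered cov X′≡2 (z , z-off , z∈ , pz , z-hub) with 1 ≤? q z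
    ... | yes qz = z , z-off , z∈ , qz , λ k 2≤C′ → z-hub k (≤-trans 2≤C′ (C′≤C (cov k)))
    ... | no ¬qz = u , u-off , target∈ , target-pebbled , u-hub
      where
      u-hub : ∀ k → 2 ≤ C′ k → onLine k u ≡ 1
      u-hub k 2≤C′ with onLine-01 k u
      ... | inj₂ on  = on
      ... | inj₁ off = ⊥-elim (over-budget X′≡2 X≤2 (subst (X′ + 1 ≤_) (sym (+-identityʳ X))
              (excess-drop N {C′} {C} (load-positive⇒line<1+s s q (≤-trans (s≤s z≤n) 2≤C′)) (λ j → C′≤C (cov j))
                 (pred-drop₁ {C′ k} {C k} (drop-where-not-gained off (source-hit (emptied⇒source z (n≤0⇒n≡0 (≮⇒≥ ¬qz)) pz) (z-hub k 2≤C)))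
                             2≤C))) ≤-refl)
        where
        2≤C : 2 ≤ C k
        2≤C = ≤-trans 2≤C′ (C′≤C (cov k))

    -- After a shifted move the target is a hub: a loaded line missing it would push the excess over budget.
    module Shifted {k₀ x} (k₀≢x : k₀ ≢ x) (k₀<N : k₀ < N) (x<N : x < N) (twice : spent k₀ ≡ 2)
        (cov : ∀ k → k ≢ x → Covers u v w k) (X′≡2 : X′ ≡ 2) where

      private
        2≤Ck₀ : 2 ≤ C k₀
        2≤Ck₀ = subst (_≤ C k₀) twice (spent≤C k₀)

        loaded : ∀ {k} → 2 ≤ C′ k → k < N
        loaded 2≤C′ = load-positive⇒line<1+s s q (≤-trans (s≤s z≤n) 2≤C′)

      missing-x : onLine x u ≡ 0 → ⊥
      missing-x off = over-budget X′≡2 X≤2 (subst (X′ + 1 ≤_) (sym (+-identityʳ X))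
                        (excess-drop N {C′} {C} k₀<N C′≤C-all (drop-where-spent-twice twice))) ≤-refl
        where
        C′≤C-all : ∀ j → C′ j ≤ C j
        C′≤C-all j with j ≟ x
        ... | yes refl = balance-mono (balance j) (subst (_≤ spent j) (sym off) z≤n)
        ... | no j≢x   = C′≤C (cov j j≢x)

      missing-k₀ : 2 ≤ C′ k₀ → onLine k₀ u ≡ 0 → ⊥
      missing-k₀ 2≤C′ off = over-budget X′≡2 X≤2 (excess-shift N {C′} {C} x<N (λ j j≢x → C′≤C (cov j j≢x)) (C′≤C+1 x)
                              k₀<N k₀≢x (pred-drop₂ {C′ k₀} {C k₀}
                              (balance-≤ (balance k₀) (subst (λ t → t + 2 ≤ spent k₀) (sym off) (≤-reflexive (sym twice))))
                              (≤-trans (s≤s z≤n) 2≤C′)))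
                              (s≤s (s≤s z≤n))

      missing-other : Hub s p → ∀ {k} → k ≢ x → k ≢ k₀ → 2 ≤ C′ k → onLine k u ≡ 0 → ⊥
      missing-other (z , z-off , z∈ , pz , z-hub) {k} k≢x k≢k₀ 2≤C′ off with source-or-other z v w
      ... | inj₁ z-source = over-budget X′≡2 X≤2
              (excess-shift₂ N {C′} {C} x<N (λ j j≢x → C′≤C (cov j j≢x)) (C′≤C+1 x) k≢k₀ (loaded 2≤C′) k₀<N k≢x k₀≢x
                 (pred-drop₁ (drop-where-not-gained off (source-hit z-source (z-hub k 2≤C))) 2≤C)
                 (drop-where-spent-twice twice))
              (s≤s (s≤s z≤n))
        where
        2≤C : 2 ≤ C k
        2≤C = ≤-trans 2≤C′ (C′≤C (cov k k≢x))
      ... | inj₂ (z≢v , z≢w) = <-irrefl refl (≤-trans (excess≥3 N C (k≢k₀ ∘ sym) k₀<N (loaded 2≤C′) 3≤Ck₀ 2≤C) X≤2)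
        where
        2≤C : 2 ≤ C k
        2≤C = ≤-trans 2≤C′ (C′≤C (cov k k≢x))

        3≤Ck₀ : 3 ≤ C k₀
        3≤Ck₀ = subst (_≤ C k₀) (cong₂ _+_ (trans (cong₂ _+_ (onLineOff₁-off₁ k₀ v-off) (onLineOff₁-off₁ k₀ w-off)) twice)
                                           (trans (onLineOff₁-off₁ k₀ z-off) (z-hub k₀ 2≤Ck₀)))
                      (sources+other≤load z z≢v z≢w z∈ pz k₀)

      target-hub : Hub s p → Hub s q
      target-hub hub = u , u-off , target∈ , target-pebbled , u-hub
        where
        u-hub : ∀ k → 2 ≤ C′ k → onLine k u ≡ 1
        u-hub k 2≤C′ with onLine-01 k u | k ≟ x | k ≟ k₀
        ... | inj₂ on  | _        | _        = on
        ... | inj₁ off | yes refl | _        = ⊥-elim (missing-x off)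
        ... | inj₁ off | no _     | yes refl = ⊥-elim (missing-k₀ 2≤C′ off)
        ... | inj₁ off | no k≢x   | no k≢k₀  = ⊥-elim (missing-other hub k≢x k≢k₀ 2≤C′ off)

    preserved : LineCover s u v w → Blocked s q
    preserved cover = corner-stays-empty u≢11 (proj₁ blocked) ,
                      ≤-trans (+-mono-≤ X′≤X (≤-reflexive (cong (2 *_) L′≡L))) (proj₁ (proj₂ blocked)) ,
                      hub
      where
      u≢11 : u ≢ (1 , 1)
      u≢11 u≡11 = 0≢1+n (trans (sym u-off) (onLine-fst u (cong proj₁ u≡11)))

      X′≤X : X′ ≤ X
      X′≤X = excess-nonincreasing cover

      hub : X′ ≡ 2 → Hub s q
      hub X′≡2 = hub-for cover (proj₂ (proj₂ blocked) (≤-antisym X≤2 (subst (_≤ X) X′≡2 X′≤X)))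
        where
        hub-for : LineCover s u v w → Hub s p → Hub s q
        hub-for (covered cov) = hub-if-covered cov X′≡2
        hub-for (shifted k₀ x k₀≢x k₀<N x<N twice cov) = Shifted.target-hub k₀≢x k₀<N x<N twice cov X′≡2

blocked-step : ∀ {n s p q v w u} → VertexG n s v → VertexG n s w → VertexG n s u → AdjG s v u → AdjG s w u →
  (∀ x → q x + (δ x v + δ x w) ≡ p x + δ x u) → Blocked s p → Blocked s q
blocked-step {n} {s} {p} {q} {v} {w} {u} v∈ w∈ u∈ vu wu q≡p blocked =
  byLine₁ (onLine-01 1 v) (onLine-01 1 w) (onLine-01 1 u)
  where
  open Step (moveEffect {s} {p} {q} (vertex-inGrid v v∈) (vertex-inGrid w w∈) (vertex-inGrid u u∈) (proj₁ vu) (proj₁ wu) q≡p)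

  byLine₁ : onLine 1 v ≡ 0 ⊎ onLine 1 v ≡ 1 → onLine 1 w ≡ 0 ⊎ onLine 1 w ≡ 1 → onLine 1 u ≡ 0 ⊎ onLine 1 u ≡ 1 →
    Blocked s q
  byLine₁ (inj₁ v-off) (inj₁ w-off) (inj₁ u-off) =
    OffLine₁.preserved v-off w-off u-off blocked (lineCover (vertex-inGrid u u∈) (vertex-inGrid v v∈) vu wu)
  byLine₁ (inj₁ v-off) (inj₁ w-off) (inj₂ u-on) =
    TargetEntersLine₁.preserved v-off w-off u-on u≢11 (otherLine<1+s u u∈ u-on)
      (adjacent-onOtherLine u∈ u-on u≢11 v-off vu) (adjacent-onOtherLine u∈ u-on u≢11 w-off wu) blocked
    where
    u≢11 : u ≢ (1 , 1)
    u≢11 u≡11 = 0≢1+n (trans (sym v-off) (adjacent-to-corner-onLine₁ (subst (AdjG s v) u≡11 vu)))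
  byLine₁ (inj₂ v-on) (inj₁ w-off) _ =
    OneSourceOnLine₁.preserved w-off wu (λ k → cong₂ _+_ (onLineOff₁-on₁ k v-on) (onLineOff₁-off₁ k w-off))
                                        (cong₂ _+_ v-on w-off) blocked
  byLine₁ (inj₁ v-off) (inj₂ w-on) _ =
    OneSourceOnLine₁.preserved v-off vu (λ k → trans (cong₂ _+_ (onLineOff₁-off₁ k v-off) (onLineOff₁-on₁ k w-on))
                                                     (+-identityʳ _))
                                        (cong₂ _+_ v-off w-on) blocked
  byLine₁ (inj₂ v-on) (inj₂ w-on) _ = ⊥-elim (both-sources-on-line₁ v-on w-on blocked)

blocked-move : ∀ {n s p q} → Move n s p q → Blocked s p → Blocked s q
blocked-move {q = q} (pebbling v u v∈ u∈ vu q≡p) = blocked-step v∈ v∈ u∈ vu vu λ x →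
  trans (cong (λ t → q x + (δ x v + t)) (sym (+-identityʳ (δ x v)))) (q≡p x)
blocked-move (rubbling v w u v∈ w∈ u∈ _ vu wu q≡p) = blocked-step v∈ w∈ u∈ vu wu q≡p

blocked-moves : ∀ {n s p q} → Star (Move n s) p q → Blocked s p → Blocked s q
blocked-moves ε              blocked = blocked
blocked-moves (move ◅ moves) blocked = blocked-moves moves (blocked-move move blocked)

corner-unreachable : ∀ {n s p} → Blocked s p → ¬ Reachable n s p (1 , 1)
corner-unreachable blocked (q , moves , pebbled) =
  <-irrefl refl (≤-trans pebbled (≤-reflexive (proj₁ (blocked-moves moves blocked))))

-- A blocked distribution of each size m ≤ s + 1

diagonalWeight : ℕ → ℕ → ℕ → ℕ
diagonalWeight s m i = point s i * (3 ⊓ m) + interval 2 (m ∸ 3 + 2) i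

-- min(3, m) pebbles on (s , s) and one on each (i , i) with 2 ≤ i < m - 1
initial : ℕ → ℕ → Dist
initial s m (i , j) = point i j * diagonalWeight s m i

diagonal-not-deleted : ∀ s i → ¬ Deleted s (i , i)
diagonal-not-deleted s i (inj₁ (_ , t , _ , _ , i≡ , j≡)) = even≢odd t t (trans (sym i≡) (trans j≡ (+-comm (2 * t) 1)))
diagonal-not-deleted s i (inj₂ (_ , t , 2≤t , _ , i≡ , j≡)) =
  even≢odd t t (trans (sym (suc[2t∸1] t (≤-trans (s≤s z≤n) 2≤t))) (cong suc (trans (sym i≡) j≡)))

module Initial (n s m : ℕ) (2≤s : 2 ≤ s) (s≤n : s ≤ n) (m≤1+s : m ≤ suc s) where

  private
    N = suc s
    weight = diagonalWeight s m
    p₀ = initial s m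

    top : m ∸ 3 + 2 ≤ s
    top = ≤-trans (+-monoˡ-≤ 2 (∸-monoˡ-≤ 3 m≤1+s)) (≤-reflexive (m∸n+n≡m 2≤s))

    1≢s : 1 ≢ s
    1≢s 1≡s = <-irrefl 1≡s 2≤s

    weight-s : weight s ≡ 3 ⊓ m
    weight-s = trans (cong₂ _+_ (cong (_* (3 ⊓ m)) (point-self s)) (interval-above (λ s< → <-irrefl refl (≤-trans s< top))))
                     (trans (+-identityʳ _) (+-identityʳ (3 ⊓ m)))

    weight≤1 : ∀ {k} → k ≢ s → weight k ≤ 1
    weight≤1 {k} k≢s = subst (_≤ 1) (sym (cong (λ t → t * (3 ⊓ m) + interval 2 (m ∸ 3 + 2) k) (point-other k≢s)))
                             (interval≤1 2 (m ∸ 3 + 2) k)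

    weight-support : ∀ {i} → 1 ≤ weight i → 2 ≤ i × i ≤ s
    weight-support {i} pos = split (i ≟ s)
      where
      split : Dec (i ≡ s) → 2 ≤ i × i ≤ s
      split (yes refl) = 2≤s , ≤-refl
      split (no i≢s)   = let (2≤i , i<) = interval-bounds (subst (1 ≤_) (cong (λ t → t * (3 ⊓ m) + interval 2 (m ∸ 3 + 2) i)
                                                                               (point-other i≢s)) pos)
                         in 2≤i , ≤-trans (<⇒≤ i<) top

    p₀-diagonal : ∀ i → p₀ (i , i) ≡ weight i
    p₀-diagonal i = trans (cong (_* weight i) (point-self i)) (+-identityʳ (weight i))

    p₀-off-diagonal : ∀ {i j} → j ≢ i → p₀ (i , j) ≡ 0
    p₀-off-diagonal {i} j≢i = cong (_* weight i) (point-other j≢i)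

    load-diagonal : ∀ k → k < N → load s p₀ k ≤ weight k
    load-diagonal k k<N =
      ≤-trans (≤-reflexive (gridSum-concentrated N (λ x → onLineOff₁ k x * p₀ x) (k<N , k<N) elsewhere))
              (≤-trans (*-monoˡ-≤ (p₀ (k , k)) (onLineOff₁≤1 k (k , k))) (≤-reflexive (trans (+-identityʳ _) (p₀-diagonal k))))
      where
      elsewhere : ∀ x → x ≢ (k , k) → onLineOff₁ k x * p₀ x ≡ 0
      elsewhere (i , j) x≢kk with ≡⊎≢ j i
      ... | inj₂ j≢i  = trans (cong (onLineOff₁ k (i , j) *_) (p₀-off-diagonal j≢i)) (*-zeroʳ (onLineOff₁ k (i , j)))
      ... | inj₁ refl = cong (_* p₀ (i , i)) (onLineOff₁-outside (onLine-outside (i , i) k≢i k≢i))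
        where
        k≢i : k ≢ i
        k≢i k≡i = x≢kk (cong (λ z → z , z) (sym k≡i))

    load≤1 : ∀ {k} → k ≢ s → load s p₀ k ≤ 1
    load≤1 {k} k≢s with k <? N
    ... | yes k<N = ≤-trans (load-diagonal k k<N) (weight≤1 k≢s)
    ... | no  k≮N = ≤-trans (≤-reflexive (load-beyond s p₀ (≮⇒≥ k≮N))) z≤n

    excess≡ : excessOf s p₀ ≡ load s p₀ s ∸ 1
    excess≡ = sumTo-concentrated N (λ k → load s p₀ k ∸ 1) ≤-refl (λ k k≢s → m≤n⇒m∸n≡0 (load≤1 k≢s))

    load₁≡0 : load₁ s p₀ ≡ 0
    load₁≡0 = trans (gridSum-cong N on₁) (gridSum-zeros N)
      where
      on₁ : ∀ x → onLine 1 x * p₀ x ≡ 0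
      on₁ (i , j) with ≡⊎≢ j i
      ... | inj₂ j≢i   = trans (cong (onLine 1 (i , j) *_) (p₀-off-diagonal j≢i)) (*-zeroʳ (onLine 1 (i , j)))
      ... | inj₁ refl with onLine-01 1 (i , i)
      ...   | inj₁ off = cong (_* p₀ (i , i)) off
      ...   | inj₂ on  = trans (cong (onLine 1 (i , i) *_) (p₀-diagonal i)) (trans (cong (onLine 1 (i , i) *_) weight-i≡0) (*-zeroʳ (onLine 1 (i , i))))
        where
        weight-i≡0 : weight i ≡ 0
        weight-i≡0 with onLine≡1⇒coordinate (i , i) on
        ... | inj₁ refl = n≤0⇒n≡0 (≮⇒≥ λ pos → <-irrefl refl (proj₁ (weight-support pos)))
        ... | inj₂ refl = n≤0⇒n≡0 (≮⇒≥ λ pos → <-irrefl refl (proj₁ (weight-support pos)))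

  diagonal∈ : ∀ i → 1 ≤ i → i ≤ s → VertexG n s (i , i)
  diagonal∈ i 1≤i i≤s = inj₁ (1≤i , ≤-refl , i≤s , diagonal-not-deleted s i)

  isDist : IsDist n s p₀
  isDist (i , j) ∉ with ≡⊎≢ j i
  ... | inj₂ j≢i   = p₀-off-diagonal j≢i
  ... | inj₁ refl with weight i ≟ 0
  ...   | yes w≡0 = trans (p₀-diagonal i) w≡0
  ...   | no  w≢0 = ⊥-elim (∉ (diagonal∈ i (≤-trans (s≤s z≤n) (proj₁ support)) (proj₂ support)))
    where support = weight-support (≤∧≢⇒< z≤n (w≢0 ∘ sym))

  sized : size n p₀ ≡ m
  sized = begin
    sumTo (suc n) (λ i → sumTo (suc n) (λ j → p₀ (i , j)))
      ≡⟨ sumTo-cong (suc n) (λ i i< → trans (sumTo-concentrated (suc n) (λ j → p₀ (i , j)) i< (λ _ → p₀-off-diagonal))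
                                            (p₀-diagonal i)) ⟩
    sumTo (suc n) weight
      ≡⟨ sumTo-+ (suc n) (λ i → point s i * (3 ⊓ m)) (interval 2 (m ∸ 3 + 2)) ⟩
    sumTo (suc n) (λ i → point s i * (3 ⊓ m)) + sumTo (suc n) (interval 2 (m ∸ 3 + 2))
      ≡⟨ cong₂ _+_ (trans (sumTo-concentrated (suc n) _ (s≤s s≤n) (λ i i≢s → cong (_* (3 ⊓ m)) (point-other i≢s)))
                          (trans (cong (_* (3 ⊓ m)) (point-self s)) (+-identityʳ _)))
                   (trans (sumTo-interval (suc n) 2 (m ∸ 3 + 2) (≤-trans top (m≤n⇒m≤1+n s≤n))) (m+n∸n≡m (m ∸ 3) 2)) ⟩
    3 ⊓ m + (m ∸ 3)
      ≡⟨ m⊓n+n∸m≡n 3 m ⟩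
    m ∎
    where open ≡-Reasoning

  blocked : Blocked s p₀
  blocked = trans (p₀-diagonal 1) (cong₂ _+_ (cong (_* (3 ⊓ m)) (point-other 1≢s)) (interval-below {2} {m ∸ 3 + 2} {1} λ { (s≤s ()) }))
          , subst (λ l → excessOf s p₀ + 2 * l ≤ 2) (sym load₁≡0)
                  (≤-trans (≤-reflexive (+-identityʳ _)) (subst (_≤ 2) (sym excess≡) (∸-monoˡ-≤ 1 loads≤3)))
          , hub
    where
    loads≤3 : load s p₀ s ≤ 3
    loads≤3 = ≤-trans (load-diagonal s ≤-refl) (≤-trans (≤-reflexive weight-s) (m⊓n≤m 3 m))

    hub : excessOf s p₀ ≡ 2 → Hub s p₀
    hub X≡2 = (s , s) , onLine-outside (s , s) 1≢s 1≢s , (≤-refl , ≤-refl) , pebbled ,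
              λ k 2≤load → onLine-fst (s , s) (sym (only-s 2≤load))
      where
      pebbled : 1 ≤ p₀ (s , s)
      pebbled = ≤-trans (<⇒≤ (m∸n≢0⇒n<m λ load∸1≡0 → 0≢1+n (trans (sym load∸1≡0) (trans (sym excess≡) X≡2))))
                        (≤-trans (load-diagonal s ≤-refl) (≤-reflexive (sym (p₀-diagonal s))))
      only-s : ∀ {k} → 2 ≤ load s p₀ k → k ≡ s
      only-s {k} 2≤load with ≡⊎≢ k s
      ... | inj₁ k≡s = k≡s
      ... | inj₂ k≢s = ⊥-elim (<-irrefl refl (≤-trans 2≤load (load≤1 k≢s)))

-- Bounds on |V(H'_s)|

halve-≤ : ∀ x → x / 2 * 2 ≤ x
halve-≤ x = m/n*n≤m x 2

halve-≥ : ∀ x → x ≤ x / 2 * 2 + 1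
halve-≥ x = ≤-trans (≤-reflexive (m≡m%n+[m/n]*n x 2))
                    (≤-trans (+-monoˡ-≤ (x / 2 * 2) (≤-pred (m%n<n x 2))) (≤-reflexive (+-comm 1 (x / 2 * 2))))

*2-cancel-≤ : ∀ x a → x * 2 ≤ a * 2 + 1 → x ≤ a
*2-cancel-≤ x a le with x ≤? a
... | yes x≤a = x≤a
... | no  x≰a = ⊥-elim (<-irrefl refl (≤-trans (≤-trans (≤-reflexive (double a)) (*-monoˡ-≤ 2 (≰⇒> x≰a))) le))
  where
  double : ∀ a → suc (a * 2 + 1) ≡ suc a * 2
  double = solve-∀

s≤sizeH' : ∀ s → s ≤ sizeH' s
s≤sizeH' s = m+n≤o⇒m≤o∸n s (*2-cancel-≤ (s + (s ∸ 1) / 2) (s * suc s / 2) (begin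
    (s + (s ∸ 1) / 2) * 2       ≡⟨ *-distribʳ-+ 2 s ((s ∸ 1) / 2) ⟩
    s * 2 + (s ∸ 1) / 2 * 2     ≤⟨ +-monoʳ-≤ (s * 2) (halve-≤ (s ∸ 1)) ⟩
    s * 2 + (s ∸ 1)             ≤⟨ 3s-1≤s[s+1] s ⟩
    s * suc s                   ≤⟨ halve-≥ (s * suc s) ⟩
    s * suc s / 2 * 2 + 1       ∎))
  where
  open ≤-Reasoning
  3s-1≤s[s+1] : ∀ s → s * 2 + (s ∸ 1) ≤ s * suc s
  3s-1≤s[s+1] zero    = z≤n
  3s-1≤s[s+1] (suc t) = ≤-trans (m≤m+n _ (t * t)) (≤-reflexive (identity t))
    where
    identity : ∀ t → suc t * 2 + t + t * t ≡ suc t * suc (suc t)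
    identity = solve-∀

2≤s : ∀ {n s} → 3 ≤ n → n < sizeH' (suc s) → 2 ≤ s
2≤s {s = zero}        3≤n n<1 = ⊥-elim (<-irrefl refl (≤-trans n<1 (≤-trans (s≤s z≤n) 3≤n)))
2≤s {s = suc zero}    3≤n n<3 = ⊥-elim (<-irrefl refl (≤-trans n<3 3≤n))
2≤s {s = suc (suc s)} _   _   = s≤s (s≤s z≤n)

2n≤[1+s]² : ∀ {n s} → n < sizeH' (suc s) → n * 2 ≤ suc s * suc s
2n≤[1+s]² {n} {s} n<size = +-cancelʳ-≤ (s + 2) (n * 2) (suc s * suc s) (begin
    n * 2 + (s + 2)             ≡⟨ rearrange n s ⟩
    suc n * 2 + s               ≤⟨ +-monoʳ-≤ (suc n * 2) (halve-≥ s) ⟩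
    suc n * 2 + (s / 2 * 2 + 1) ≡⟨ +-assoc (suc n * 2) (s / 2 * 2) 1 ⟨
    suc n * 2 + s / 2 * 2 + 1   ≡⟨ cong (_+ 1) (*-distribʳ-+ 2 (suc n) (s / 2)) ⟨
    (suc n + s / 2) * 2 + 1     ≤⟨ +-monoˡ-≤ 1 (*-monoˡ-≤ 2 (m≤o∸n⇒m+n≤o (suc n) s/2≤A/2 n<size)) ⟩
    A / 2 * 2 + 1               ≤⟨ +-monoˡ-≤ 1 (halve-≤ A) ⟩
    A + 1                       ≡⟨ expand s ⟩
    suc s * suc s + (s + 2)     ∎)
  where
  open ≤-Reasoning
  A = suc s * suc (suc s)

  s/2≤A/2 : s / 2 ≤ A / 2
  s/2≤A/2 = <⇒≤ (m∸n≢0⇒n<m λ A/2∸s/2≡0 → <-irrefl refl (≤-trans (s≤s z≤n) (≤-trans n<size (≤-reflexive A/2∸s/2≡0))))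

  rearrange : ∀ n s → n * 2 + (s + 2) ≡ suc n * 2 + s
  rearrange = solve-∀

  expand : ∀ s → suc s * suc (suc s) + 1 ≡ suc s * suc s + (s + 2)
  expand = solve-∀

r<1+s : ∀ {n s r} → 1 ≤ n → n < sizeH' (suc s) → r * r ≤ 2 * n ∸ 1 → r < suc s
r<1+s {n} {s} {r} 1≤n n<size r²≤ with r <? suc s
... | yes r<1+s = r<1+s
... | no  r≮1+s = ⊥-elim (<-irrefl refl (≤-trans 2n-1<[1+s]² (≤-trans (*-mono-≤ 1+s≤r 1+s≤r) r²≤)))
  where
  1+s≤r : suc s ≤ r
  1+s≤r = ≮⇒≥ r≮1+s

  2n-1<[1+s]² : 2 * n ∸ 1 < suc s * suc s
  2n-1<[1+s]² = ≤-trans (≤-reflexive (trans (+-comm 1 (2 * n ∸ 1)) (m∸n+n≡m (≤-trans 1≤n (m≤m+n n (n + 0))))))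
                        (≤-trans (≤-reflexive (*-comm 2 n)) (2n≤[1+s]² {n} {s} n<size))

mainTheorem3 : (n s r : ℕ) → 3 ≤ n →
    sizeH' s ≤ n → n < sizeH' (suc s) →
    r * r ≤ 2 * n ∸ 1 → 2 * n ∸ 1 < suc r * suc r →
    (m : ℕ) → m ≤ r + 1 → ¬ AllReachable n s m
mainTheorem3 n s r 3≤n size≤n n<size r²≤ _ m m≤r+1 allReachable =
  corner-unreachable blocked (allReachable (initial s m) isDist sized (1 , 1) (diagonal∈ 1 ≤-refl (≤-trans (s≤s z≤n) 2≤s′)))
  where
  2≤s′ : 2 ≤ s
  2≤s′ = 2≤s {n} {s} 3≤n n<size

  m≤1+s : m ≤ suc s
  m≤1+s = ≤-trans m≤r+1 (≤-trans (≤-reflexive (+-comm r 1)) (r<1+s {n} {s} (≤-trans (s≤s z≤n) 3≤n) n<size r²≤))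

  open Initial n s m 2≤s′ (≤-trans (s≤sizeH' s) size≤n) m≤1+s
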